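{- Let $d=(L,Z)$ be a pure Euler diagram such that for each missing zone $z\in M(d)$ there is a contour $\ell\in L$ with $\mathrm{adj}(z,\ell)\in M(d)$. Let $L'=\{c\in L\mid M(d\setminus c)\neq\emptyset\}$. Then for every Heyting algebra and every valuation $v$, $$\bigwedge_{c\in L'} v(d\setminus c)=v(d).$$
   Context: Fix a countable set $\mathcal V$ of propositional variables (contours). A Heyting algebra $(H,\vee,\wedge,\to,0,1)$ is a bounded distributive lattice with relative pseudo-complement $\to$ ($c\wedge a\le b$ iff $c\le a\to b$); empty meets are $1$ and empty joins are $0$. A valuation is a map $v:\mathcal V\to H$. A zone for a finite set $L\subset\mathcal V$ is a pair $z=(z^{in},z^{out})$ of disjoint subsets of $L$ with union $L$; $\mathcal Z(L)$ is the set of all zones for $L$. The missing-zone semantics of $z$ is $m_v(z)=\big(\bigwedge_{c\in z^{in}}v(c)\big)\to\big(\bigvee_{c\in z^{out}}v(c)\big)$. A pure Euler diagram is a pair $d=(L,Z)$ with $L\subset\mathcal V$ finite and $Z\subseteq\mathcal Z(L)$ (the visible zones); $M(d)=\mathcal Z(L)\setminus Z$ is its set of missing zones, and its semantics is $v(d)=\bigwedge_{z\in M(d)}m_v(z)$. For $c\in L$ and a zone $z=(z^{in},z^{out})$ for $L$, the zone adjacent to $z$ at $c$ is $\mathrm{adj}(z,c)=(z^{in}\cup\{c\},z^{out}\setminus\{c\})$ if $c\in z^{out}$ and $(z^{in}\setminus\{c\},z^{out}\cup\{c\})$ if $c\in z^{in}$. The reduction of $z$ by $c$ is $z\setminus c=(z^{in}\setminus\{c\},z^{out}\setminus\{c\})$,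 and the reduction of $d=(L,Z)$ by $c\in L$ is the pure Euler diagram $d\setminus c=(L\setminus\{c\},\{z\setminus c\mid z\in Z\})$. -}

module Defs where

open import Level using (Level)
open import Data.Nat using (ℕ)
open import Data.Bool using (Bool; true; false; not; if_then_else_) renaming (_∧_ to _and_)
open import Data.Bool.Properties renaming (_≟_ to _≟ᵇ_)
open import Data.Product using (_×_; _,_)
open import Data.List using (List; []; _∷_; map; concatMap; foldr; filterᵇ)
open import Data.Bool.ListAction using (any)
open import Data.List.Relation.Unary.All as All using (All; []; _∷_)
open import Data.List.Relation.Unary.Any using (here; there)
open import Data.List.Membership.Propositional using (_∈_; mapWith∈)
open import Relation.Binary.PropositionalEquality using (_≡_; refl; cong₂)
open import Relation.Nullary using (Dec; yes; no; does)
open import Relation.Binary.Lattice.Bundles using (HeytingAlgebra)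

-- Contours (propositional variables): the countable set 𝒱 is ℕ.
Contour : Set
Contour = ℕ

-- A zone for a finite (duplicate-free) list L of contours: one Bool per
-- contour of L, true = the contour is in z^in, false = it is in z^out.
Zone : List Contour → Set
Zone L = All (λ _ → Bool) L

_≟z_ : ∀ {L} (z w : Zone L) → Dec (z ≡ w)
[] ≟z [] = yes refl
(b ∷ z) ≟z (b' ∷ w) with b ≟ᵇ b' | z ≟z w
... | yes refl | yes refl = yes refl
... | no ne | _ = no λ { refl → ne refl }
... | yes _ | no ne = no λ { refl → ne refl }

allZones : (L : List Contour) → List (Zone L)
allZones [] = [] ∷ []
allZones (c ∷ L) = concatMap (λ z → (true ∷ z) ∷ (false ∷ z) ∷ []) (allZones L)

_∖ₗ_ : ∀ {c} (L : List Contour) → c ∈ L → List Contour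
(x ∷ L) ∖ₗ here _  = L
(x ∷ L) ∖ₗ there p = x ∷ (L ∖ₗ p)

reduceZone : ∀ {c} {L : List Contour} (p : c ∈ L) → Zone L → Zone (L ∖ₗ p)
reduceZone (here _)  (b ∷ z) = z
reduceZone (there p) (b ∷ z) = b ∷ reduceZone p z

adj : ∀ {c} {L : List Contour} → Zone L → c ∈ L → Zone L
adj z p = All.updateAt p not z

-- A pure Euler diagram (L , Z); Z ⊆ 𝒵(L) given by its (decidable)
-- characteristic function.
record Diagram : Set where
  constructor diagram
  field
    contours : List Contour
    visible  : Zone contours → Bool
open Diagram public

Missing : (d : Diagram) → Zone (contours d) → Set
Missing d z = visible d z ≡ false

missingZones : (d : Diagram) → List (Zone (contours d))
missingZones d = filterᵇ (λ z → not (visible d z)) (allZones (contours d))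

hasMissing : Diagram → Bool
hasMissing d = any (λ z → not (visible d z)) (allZones (contours d))

-- reduction d ∖ c = (L ∖ {c}, { z ∖ c | z ∈ Z })
_∖_ : ∀ {c} (d : Diagram) → c ∈ contours d → Diagram
contours (d ∖ p) = contours d ∖ₗ p
visible  (d ∖ p) w =
  any (λ z → visible d z and does (reduceZone p z ≟z w)) (allZones (contours d))

module Semantics {c ℓ₁ ℓ₂ : Level} (H : HeytingAlgebra c ℓ₁ ℓ₂) where
  open HeytingAlgebra H

  ⋀ : List Carrier → Carrier
  ⋀ = foldr _∧_ ⊤

  ⋁ : List Carrier → Carrier
  ⋁ = foldr _∨_ ⊥

  Valuation : Set c
  Valuation = Contour → Carrier

  inVals : (v : Valuation) {L : List Contour} → Zone L → List Carrier
  inVals v {[]} [] = []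
  inVals v {x ∷ L} (true ∷ z) = v x ∷ inVals v z
  inVals v {x ∷ L} (false ∷ z) = inVals v z

  outVals : (v : Valuation) {L : List Contour} → Zone L → List Carrier
  outVals v {[]} [] = []
  outVals v {x ∷ L} (true ∷ z) = outVals v z
  outVals v {x ∷ L} (false ∷ z) = v x ∷ outVals v z

  mzone : (v : Valuation) {L : List Contour} → Zone L → Carrier
  mzone v z = ⋀ (inVals v z) ⇨ ⋁ (outVals v z)

  ⟦_⟧ : Diagram → Valuation → Carrier
  ⟦ d ⟧ v = ⋀ (map (mzone v) (missingZones d))

  -- ⋀_{c ∈ L'} v(d ∖ c)  where  L' = { c ∈ L | M(d ∖ c) ≠ ∅ }
  reducedMeet : Diagram → Valuation → Carrier
  reducedMeet d v =
    ⋀ (concatMap (λ x → x)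
        (mapWith∈ (contours d)
          (λ p → if hasMissing (d ∖ p) then ⟦ d ∖ p ⟧ v ∷ [] else [])))

-- Write A ⇨ B for m_v(w). For every contour c, v(d) ≤ v(d ∖ c): a zone w missing in d ∖ c has both
-- of its extensions by c missing in d, and (v c ∧ A ⇨ B) ∧ (A ⇨ v c ∨ B) ≤ A ⇨ B by distributivity.
-- Conversely, if z and adj(z, c) are both missing in d then z ∖ c is missing in d ∖ c, so c ∈ L',
-- and m_v(z ∖ c) ≤ m_v(z) because adding c to either side only weakens the implication. Hence the
-- meet over L' lies below every m_v(z) with z ∈ M(d), i.e. below v(d).

module Submission where

open import Defs
open import Level using (Level)
open import Data.Bool using (Bool; true; false; not; T; T?; if_then_else_)
  renaming (_≟_ to _≟ᵇ_; _∧_ to _∧ᵇ_)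
open import Data.Bool.Properties using (¬-not; not-¬; T-≡; T-not-≡; ∧-identityʳ; ∧-zeroʳ)
open import Data.Bool.ListAction using (any)
open import Data.List using (List; []; _∷_; map; concatMap)
open import Data.List.Membership.Propositional using (_∈_; mapWith∈; lose; find)
open import Data.List.Membership.Propositional.Properties
  using (∈-map⁺; ∈-map⁻; ∈-filter⁺; ∈-filter⁻; ∈-concatMap⁺; ∈-concatMap⁻)
open import Data.List.Relation.Binary.Permutation.Propositional
  using (_↭_; ↭-refl; ↭-prep; ↭-swap; ↭-sym; ↭-trans)
open import Data.List.Relation.Binary.Permutation.Propositional.Properties using (∈-resp-↭)
open import Data.List.Relation.Binary.Subset.Propositional using (_⊆_)
open import Data.List.Relation.Unary.All as All using ([]; _∷_)
open import Data.List.Relation.Unary.Any as Any using (here; there)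
open import Data.List.Relation.Unary.Any.Properties using (any⁺; any⁻; mapWith∈⁺; mapWith∈⁻)
open import Data.List.Relation.Unary.Unique.Propositional using (Unique)
open import Data.Product using (Σ; ∃; _×_; _,_; proj₂)
open import Data.Sum using (_⊎_; inj₁; inj₂)
open import Data.Empty using (⊥)
open import Function using (id; _∘_; Equivalence)
open import Relation.Binary.Lattice.Bundles using (HeytingAlgebra)
open import Relation.Binary.PropositionalEquality using (_≡_; refl; sym; trans; cong; subst)
open import Relation.Nullary using (Dec; yes; no; does; contradiction)

open Equivalence using (to; from)

private
  variable
    a : Level
    A : Set a
    c : Contour
    L : List Contour

any-≡true : (P : A → Bool) {x : A} {xs : List A} → x ∈ xs → P x ≡ true → any P xs ≡ true
any-≡true P x∈xs Px = to T-≡ (any⁺ P (lose x∈xs (from T-≡ Px)))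

any-≡false⁻ : (P : A → Bool) {x : A} {xs : List A} → any P xs ≡ false → x ∈ xs → P x ≡ false
any-≡false⁻ P anyP x∈xs = ¬-not (not-¬ anyP ∘ any-≡true P x∈xs)

any-≡false⁺ : (P : A → Bool) (xs : List A) → (∀ {x} → x ∈ xs → P x ≡ false) → any P xs ≡ false
any-≡false⁺ P xs noneP = ¬-not λ anyP → witness (find (any⁻ P xs (from T-≡ anyP)))
  where
  witness : (∃ λ x → x ∈ xs × T (P x)) → ⊥
  witness (x , x∈xs , Px) = not-¬ (noneP x∈xs) (to T-≡ Px)

∈-allZones : (z : Zone L) → z ∈ allZones L
∈-allZones []      = here refl
∈-allZones (b ∷ z) = ∈-concatMap⁺ _ (Any.map (λ { refl → ∈-extensions b }) (∈-allZones z))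
  where
  ∈-extensions : ∀ b → (b ∷ z) ∈ (true ∷ z) ∷ (false ∷ z) ∷ []
  ∈-extensions true  = here refl
  ∈-extensions false = there (here refl)

insertZone : (p : c ∈ L) → Bool → Zone (L ∖ₗ p) → Zone L
insertZone (here _)  b w        = b ∷ w
insertZone (there p) b (b′ ∷ w) = b′ ∷ insertZone p b w

reduce-insert : (p : c ∈ L) (b : Bool) (w : Zone (L ∖ₗ p))
  → reduceZone p (insertZone p b w) ≡ w
reduce-insert (here _)  b w        = refl
reduce-insert (there p) b (b′ ∷ w) = cong (b′ ∷_) (reduce-insert p b w)

insert-reduce : (p : c ∈ L) (z : Zone L)
  → insertZone p (All.lookup z p) (reduceZone p z) ≡ z
insert-reduce (here refl) (b ∷ z) = refl
insert-reduce (there p)   (b ∷ z) = cong (b ∷_) (insert-reduce p z)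

insert-reduce-not : (p : c ∈ L) (z : Zone L)
  → insertZone p (not (All.lookup z p)) (reduceZone p z) ≡ adj z p
insert-reduce-not (here refl) (b ∷ z) = refl
insert-reduce-not (there p)   (b ∷ z) = cong (b ∷_) (insert-reduce-not p z)

reduce-fibre : (p : c ∈ L) {z z′ : Zone L}
  → reduceZone p z′ ≡ reduceZone p z → z′ ≡ z ⊎ z′ ≡ adj z p
reduce-fibre p {z} {z′} same-reduct = by-bit-at-p (All.lookup z′ p ≟ᵇ All.lookup z p)
  where
  z′≡ : z′ ≡ insertZone p (All.lookup z′ p) (reduceZone p z)
  z′≡ = trans (sym (insert-reduce p z′)) (cong (insertZone p _) same-reduct)

  by-bit-at-p : Dec (All.lookup z′ p ≡ All.lookup z p) → z′ ≡ z ⊎ z′ ≡ adj z p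
  by-bit-at-p (yes same)  =
    inj₁ (trans z′≡ (trans (cong (λ b → insertZone p b _) same) (insert-reduce p z)))
  by-bit-at-p (no differ) =
    inj₂ (trans z′≡ (trans (cong (λ b → insertZone p b _) (¬-not differ)) (insert-reduce-not p z)))

hasMissing-intro : (e : Diagram) {z : Zone (contours e)} → Missing e z → hasMissing e ≡ true
hasMissing-intro e {z} missing = any-≡true _ (∈-allZones z) (cong not missing)

module _ (d : Diagram) (p : c ∈ contours d) where

  missing-∖⁻ : {w : Zone (contours d ∖ₗ p)} {z : Zone (contours d)}
    → Missing (d ∖ p) w → reduceZone p z ≡ w → Missing d z
  missing-∖⁻ {w} {z} missing reduct
    with reduceZone p z ≟z w | any-≡false⁻ _ missing (∈-allZones z)
  ... | yes _ | invisible = trans (sym (∧-identityʳ _)) invisible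
  ... | no ≢w | _         = contradiction reduct ≢w

  missing-∖⁺ : {w : Zone (contours d ∖ₗ p)}
    → (∀ z → reduceZone p z ≡ w → Missing d z) → Missing (d ∖ p) w
  missing-∖⁺ {w} fibreMissing = any-≡false⁺ _ _ invisible
    where
    invisible : ∀ {z} → z ∈ allZones (contours d)
      → (visible d z ∧ᵇ does (reduceZone p z ≟z w)) ≡ false
    invisible {z} _ with reduceZone p z ≟z w
    ... | yes reduct = trans (∧-identityʳ _) (fibreMissing z reduct)
    ... | no _       = ∧-zeroʳ _

  missing-insert : {w : Zone (contours d ∖ₗ p)} (b : Bool)
    → Missing (d ∖ p) w → Missing d (insertZone p b w)
  missing-insert {w} b missing = missing-∖⁻ missing (reduce-insert p b w)

  missing-reduce : {z : Zone (contours d)}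
    → Missing d z → Missing d (adj z p) → Missing (d ∖ p) (reduceZone p z)
  missing-reduce {z} missing missingAdj = missing-∖⁺ λ z′ reduct → by-fibre (reduce-fibre p reduct)
    where
    by-fibre : ∀ {z′} → z′ ≡ z ⊎ z′ ≡ adj z p → Missing d z′
    by-fibre (inj₁ refl) = missing
    by-fibre (inj₂ refl) = missingAdj

module SemanticsProperties {ℓ ℓ₁ ℓ₂ : Level} (H : HeytingAlgebra ℓ ℓ₁ ℓ₂) where
  open HeytingAlgebra H renaming (refl to ≤-refl; trans to ≤-trans)
  open import Relation.Binary.Lattice.Properties.HeytingAlgebra H 
    using (⇨-relax; ⇨-cong; ∧-distribˡ-∨-≤)
  open import Relation.Binary.Lattice.Properties.MeetSemilattice meetSemilattice
    using (∧-monotonic)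
  open import Relation.Binary.Reasoning.PartialOrder poset
  open Semantics H

  ⋀-lowerBound : ∀ {x xs} → x ∈ xs → ⋀ xs ≤ x
  ⋀-lowerBound (here refl) = x∧y≤x _ _
  ⋀-lowerBound (there x∈xs) = ≤-trans (x∧y≤y _ _) (⋀-lowerBound x∈xs)

  ⋀-greatest : ∀ {y} xs → (∀ {x} → x ∈ xs → y ≤ x) → y ≤ ⋀ xs
  ⋀-greatest []       _      = maximum _
  ⋀-greatest (x ∷ xs) bounds = ∧-greatest (bounds (here refl)) (⋀-greatest xs (bounds ∘ there))

  ⋁-upperBound : ∀ {x xs} → x ∈ xs → x ≤ ⋁ xs
  ⋁-upperBound (here refl) = x≤x∨y _ _
  ⋁-upperBound (there x∈xs) = ≤-trans (⋁-upperBound x∈xs) (y≤x∨y _ _)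

  ⋁-least : ∀ {y} xs → (∀ {x} → x ∈ xs → x ≤ y) → ⋁ xs ≤ y
  ⋁-least []       _      = minimum _
  ⋁-least (x ∷ xs) bounds = ∨-least (bounds (here refl)) (⋁-least xs (bounds ∘ there))

  ⋀-antitone : ∀ {xs ys} → xs ⊆ ys → ⋀ ys ≤ ⋀ xs
  ⋀-antitone {xs} xs⊆ys = ⋀-greatest xs (⋀-lowerBound ∘ xs⊆ys)

  ⋁-monotone : ∀ {xs ys} → xs ⊆ ys → ⋁ xs ≤ ⋁ ys
  ⋁-monotone {xs} xs⊆ys = ⋁-least xs (⋁-upperBound ∘ xs⊆ys)

  ⋀-resp-↭ : ∀ {xs ys} → xs ↭ ys → ⋀ xs ≈ ⋀ ys
  ⋀-resp-↭ xs↭ys = antisym (⋀-antitone (∈-resp-↭ (↭-sym xs↭ys))) (⋀-antitone (∈-resp-↭ xs↭ys))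

  ⋁-resp-↭ : ∀ {xs ys} → xs ↭ ys → ⋁ xs ≈ ⋁ ys
  ⋁-resp-↭ xs↭ys = antisym (⋁-monotone (∈-resp-↭ xs↭ys)) (⋁-monotone (∈-resp-↭ (↭-sym xs↭ys)))

  ⇨-by-cases : ∀ {x y z} → (x ∧ y ⇨ z) ∧ (y ⇨ x ∨ z) ≤ y ⇨ z
  ⇨-by-cases {x} {y} {z} = transpose-⇨ (begin
    h ∧ y                     ≤⟨ ∧-greatest ≤-refl y≤x∨z ⟩
    (h ∧ y) ∧ (x ∨ z)         ≤⟨ ∧-distribˡ-∨-≤ _ _ _ ⟩
    (h ∧ y) ∧ x ∨ (h ∧ y) ∧ z ≤⟨ ∨-least x⇒z (x∧y≤y _ _) ⟩
    z                         ∎)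
    where
    h : Carrier
    h = (x ∧ y ⇨ z) ∧ (y ⇨ x ∨ z)
    y≤x∨z : h ∧ y ≤ x ∨ z
    y≤x∨z = transpose-∧ (x∧y≤y _ _)
    x⇒z : (h ∧ y) ∧ x ≤ z
    x⇒z = begin
      (h ∧ y) ∧ x   ≤⟨ ∧-greatest (≤-trans (x∧y≤x _ _) (x∧y≤x _ _))
                                  (∧-greatest (x∧y≤y _ _) (≤-trans (x∧y≤x _ _) (x∧y≤y _ _))) ⟩
      h ∧ (x ∧ y)   ≤⟨ transpose-∧ (x∧y≤x _ _) ⟩
      z             ∎

  module _ (v : Valuation) where

    inVals-insert-true : (p : c ∈ L) (w : Zone (L ∖ₗ p))
      → inVals v (insertZone p true w) ↭ v c ∷ inVals v w
    inVals-insert-true (here refl) w           = ↭-refl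
    inVals-insert-true (there p)   (true ∷ w)  =
      ↭-trans (↭-prep _ (inVals-insert-true p w)) (↭-swap _ _ ↭-refl)
    inVals-insert-true (there p)   (false ∷ w) = inVals-insert-true p w

    inVals-insert-false : (p : c ∈ L) (w : Zone (L ∖ₗ p))
      → inVals v (insertZone p false w) ≡ inVals v w
    inVals-insert-false (here refl) w           = refl
    inVals-insert-false (there p)   (true ∷ w)  = cong (_ ∷_) (inVals-insert-false p w)
    inVals-insert-false (there p)   (false ∷ w) = inVals-insert-false p w

    outVals-insert-true : (p : c ∈ L) (w : Zone (L ∖ₗ p))
      → outVals v (insertZone p true w) ≡ outVals v w
    outVals-insert-true (here refl) w           = refl
    outVals-insert-true (there p)   (true ∷ w)  = outVals-insert-true p w
    outVals-insert-true (there p)   (false ∷ w) = cong (_ ∷_) (outVals-insert-true p w)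

    outVals-insert-false : (p : c ∈ L) (w : Zone (L ∖ₗ p))
      → outVals v (insertZone p false w) ↭ v c ∷ outVals v w
    outVals-insert-false (here refl) w           = ↭-refl
    outVals-insert-false (there p)   (true ∷ w)  = outVals-insert-false p w
    outVals-insert-false (there p)   (false ∷ w) =
      ↭-trans (↭-prep _ (outVals-insert-false p w)) (↭-swap _ _ ↭-refl)

    mzone-insert-true : (p : c ∈ L) (w : Zone (L ∖ₗ p))
      → mzone v (insertZone p true w) ≈ (v c ∧ ⋀ (inVals v w) ⇨ ⋁ (outVals v w))
    mzone-insert-true p w =
      ⇨-cong (⋀-resp-↭ (inVals-insert-true p w)) (Eq.reflexive (cong ⋁ (outVals-insert-true p w)))

    mzone-insert-false : (p : c ∈ L) (w : Zone (L ∖ₗ p))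
      → mzone v (insertZone p false w) ≈ (⋀ (inVals v w) ⇨ v c ∨ ⋁ (outVals v w))
    mzone-insert-false p w =
      ⇨-cong (Eq.reflexive (cong ⋀ (inVals-insert-false p w))) (⋁-resp-↭ (outVals-insert-false p w))

    mzone-≤-insert : (p : c ∈ L) (b : Bool) (w : Zone (L ∖ₗ p))
      → mzone v w ≤ mzone v (insertZone p b w)
    mzone-≤-insert p true w = begin
      mzone v w                                  ≤⟨ ⇨-relax (x∧y≤y _ _) ≤-refl ⟩
      (v _ ∧ ⋀ (inVals v w) ⇨ ⋁ (outVals v w))  ≈⟨ mzone-insert-true p w ⟨
      mzone v (insertZone p true w)              ∎
    mzone-≤-insert p false w = begin
      mzone v w                                  ≤⟨ ⇨-relax ≤-refl (y≤x∨y _ _) ⟩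
      (⋀ (inVals v w) ⇨ v _ ∨ ⋁ (outVals v w))  ≈⟨ mzone-insert-false p w ⟨
      mzone v (insertZone p false w)             ∎

    mzone-insert-both : (p : c ∈ L) (w : Zone (L ∖ₗ p))
      → mzone v (insertZone p true w) ∧ mzone v (insertZone p false w) ≤ mzone v w
    mzone-insert-both p w = begin
      mzone v (insertZone p true w) ∧ mzone v (insertZone p false w)
        ≤⟨ ∧-monotonic (reflexive (mzone-insert-true p w)) (reflexive (mzone-insert-false p w)) ⟩
      (v _ ∧ ⋀ (inVals v w) ⇨ ⋁ (outVals v w)) ∧ (⋀ (inVals v w) ⇨ v _ ∨ ⋁ (outVals v w))
        ≤⟨ ⇨-by-cases ⟩
      mzone v w
        ∎

    mzone-reduce-≤ : (p : c ∈ L) (z : Zone L) → mzone v (reduceZone p z) ≤ mzone v z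
    mzone-reduce-≤ p z = subst (mzone v (reduceZone p z) ≤_) (cong (mzone v) (insert-reduce p z))
                               (mzone-≤-insert p (All.lookup z p) (reduceZone p z))

    ⟦⟧-≤-mzone : (e : Diagram) {z : Zone (contours e)} → Missing e z → ⟦ e ⟧ v ≤ mzone v z
    ⟦⟧-≤-mzone e {z} missing =
      ⋀-lowerBound (∈-map⁺ (mzone v)
        (∈-filter⁺ (T? ∘ not ∘ visible e) (∈-allZones z) (from T-not-≡ missing)))

    ⟦⟧-greatest : (e : Diagram) {y : Carrier} → (∀ z → Missing e z → y ≤ mzone v z) → y ≤ ⟦ e ⟧ v
    ⟦⟧-greatest e {y} bounds = ⋀-greatest _ bound
      where
      bound : ∀ {x} → x ∈ map (mzone v) (missingZones e) → y ≤ x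
      bound x∈ with ∈-map⁻ (mzone v) x∈
      ... | z , z∈M , refl =
        bounds z (to T-not-≡ (proj₂
          (∈-filter⁻ (T? ∘ not ∘ visible e) {xs = allZones (contours e)} z∈M)))

    ⟦⟧-≤-∖ : (d : Diagram) (p : c ∈ contours d) → ⟦ d ⟧ v ≤ ⟦ d ∖ p ⟧ v
    ⟦⟧-≤-∖ d p = ⟦⟧-greatest (d ∖ p) λ w missing → begin
      ⟦ d ⟧ v
        ≤⟨ ∧-greatest (⟦⟧-≤-mzone d (missing-insert d p true missing))
                      (⟦⟧-≤-mzone d (missing-insert d p false missing)) ⟩
      mzone v (insertZone p true w) ∧ mzone v (insertZone p false w)
        ≤⟨ mzone-insert-both p w ⟩
      mzone v w
        ∎

    module _ (d : Diagram) where

      reductionTerm : c ∈ contours d → List Carrier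
      reductionTerm p = if hasMissing (d ∖ p) then ⟦ d ∖ p ⟧ v ∷ [] else []

      ∈-reductionTerm : {x : Carrier} (p : c ∈ contours d)
        → x ∈ reductionTerm p → x ≡ ⟦ d ∖ p ⟧ v
      ∈-reductionTerm p x∈ with hasMissing (d ∖ p)
      ∈-reductionTerm p (here x≡) | true = x≡

      reducedMeet-≤ : (p : c ∈ contours d)
        → hasMissing (d ∖ p) ≡ true → reducedMeet d v ≤ ⟦ d ∖ p ⟧ v
      reducedMeet-≤ p hasMissing-d∖p =
        ⋀-lowerBound (∈-concatMap⁺ id (mapWith∈⁺ reductionTerm (_ , p , ∈-term)))
        where
        ∈-term : ⟦ d ∖ p ⟧ v ∈ reductionTerm p
        ∈-term rewrite hasMissing-d∖p = here refl

      reducedMeet-greatest : {y : Carrier}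
        → (∀ {c} (p : c ∈ contours d) → y ≤ ⟦ d ∖ p ⟧ v) → y ≤ reducedMeet d v
      reducedMeet-greatest {y} bounds = ⋀-greatest _ bound
        where
        bound : ∀ {x} → x ∈ concatMap id (mapWith∈ (contours d) reductionTerm) → y ≤ x
        bound x∈ with mapWith∈⁻ (contours d) reductionTerm (∈-concatMap⁻ id x∈)
        ... | _ , p , x∈term with refl ← ∈-reductionTerm p x∈term = bounds p

      reducedMeet-≤-mzone : (p : c ∈ contours d) {z : Zone (contours d)}
        → Missing d z → Missing d (adj z p) → reducedMeet d v ≤ mzone v z
      reducedMeet-≤-mzone p {z} missing missingAdj = begin
        reducedMeet d v           ≤⟨ reducedMeet-≤ p (hasMissing-intro (d ∖ p) reducedMissing) ⟩
        ⟦ d ∖ p ⟧ v               ≤⟨ ⟦⟧-≤-mzone (d ∖ p) reducedMissing ⟩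
        mzone v (reduceZone p z)  ≤⟨ mzone-reduce-≤ p z ⟩
        mzone v z                 ∎
        where
        reducedMissing : Missing (d ∖ p) (reduceZone p z)
        reducedMissing = missing-reduce d p missing missingAdj

lemma5 : (d : Diagram) → Unique (contours d)
  → (∀ (z : Zone (contours d)) → Missing d z
       → ∃ λ ℓ → Σ (ℓ ∈ contours d) λ p → Missing d (adj z p))
  → ∀ {c ℓ₁ ℓ₂ : Level} (H : HeytingAlgebra c ℓ₁ ℓ₂) (v : Semantics.Valuation H)
  → HeytingAlgebra._≈_ H (Semantics.reducedMeet H d v) (Semantics.⟦_⟧ H d v)
lemma5 d _ adjacentMissing H v =
  antisym (⟦⟧-greatest v d reducedMeet-≤-missing) (reducedMeet-greatest v d (⟦⟧-≤-∖ v d))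
  where
  open HeytingAlgebra H using (_≤_; antisym)
  open Semantics H using (reducedMeet; mzone)
  open SemanticsProperties H

  reducedMeet-≤-missing : ∀ z → Missing d z → reducedMeet d v ≤ mzone v z
  reducedMeet-≤-missing z missing with adjacentMissing z missing
  ... | _ , p , missingAdj = reducedMeet-≤-mzone v d p missing missingAdj
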